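{- Let $G$ be a connected graph, let $M$ be a minimal matching cut of $G$, and let $G'$ be the underlying simple graph of $G/M$. Then $md(G') \le md(G) - 1$.
   Context: A matching cut of $G$ is an edge-cut of $G$ (the set of edges between $X$ and $V(G)\setminus X$ for some nonempty proper subset $X$ of $V(G)$) that is a matching; minimal means inclusion-minimal among matching cuts. $G/M$ is the (possibly multi-)graph obtained by contracting each edge of $M$ (deleting it and identifying its ends); its underlying simple graph is obtained by replacing parallel edges by single edges. An edge-coloring of a graph $G$ is a map $\Gamma: E(G) \to [k]$ (adjacent edges may receive the same color). An edge-cut is monochromatic if all of its edges have the same color. An edge-coloring is a monochromatic disconnection coloring (MD-coloring) if any two distinct vertices $u,v$ are separated by a monochromatic edge-cut (equivalently, for some color $i$, $u$ and $v$ lie in different components of the graph obtained by deleting all edges of color $i$). For a connected graph $G$, $md(G)$ is the maximum number of colors in an MD-coloring of $G$. -}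

module Defs where

open import Data.Nat using (ℕ; zero; suc; _≤_; _∸_)
open import Data.Fin using (Fin)
open import Data.Bool using (Bool; true; false; T)
open import Data.Product using (Σ; ∃; _×_; _,_)
open import Data.Sum using (_⊎_)
open import Relation.Nullary using (¬_)
open import Relation.Binary.PropositionalEquality using (_≡_; _≢_)

record Graph : Set where
  field
    n      : ℕ
    adj    : Fin n → Fin n → Bool
    sym    : ∀ u v → adj u v ≡ adj v u
    irrefl : ∀ u → adj u u ≡ false
open Graph public

Adj : (G : Graph) → Fin (n G) → Fin (n G) → Set
Adj G u v = T (adj G u v)

data Walk (G : Graph) : Fin (n G) → Fin (n G) → Set where
  here : ∀ {u} → Walk G u u
  step : ∀ {u v w} → Adj G u v → Walk G v w → Walk G u w

Connected : Graph → Set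
Connected G = ∀ u v → Walk G u v

EdgeSet : Graph → Set₁
EdgeSet G = Fin (n G) → Fin (n G) → Set

IsEdgeCut : (G : Graph) → EdgeSet G → Set
IsEdgeCut G M = Σ (Fin (n G) → Bool) λ X →
  (∃ λ x → X x ≡ true) × (∃ λ y → X y ≡ false) ×
  (∀ u v → (M u v → Adj G u v × X u ≢ X v) × (Adj G u v → X u ≢ X v → M u v))

IsMatching : (G : Graph) → EdgeSet G → Set
IsMatching G M = ∀ u v w → M u v → M u w → v ≡ w

IsMatchingCut : (G : Graph) → EdgeSet G → Set
IsMatchingCut G M = IsEdgeCut G M × IsMatching G M

IsMinimalMatchingCut : (G : Graph) → EdgeSet G → Set₁
IsMinimalMatchingCut G M = IsMatchingCut G M ×
  (∀ (M' : EdgeSet G) → IsMatchingCut G M' → (∀ u v → M' u v → M u v) →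
     ∀ u v → M u v → M' u v)

-- G' is (isomorphic to) the underlying simple graph of G/M:
-- π maps V(G) onto V(G'), identifying exactly the ends of edges of M,
-- and a b is an edge of G' iff a ≠ b and some edge uv ∉ M of G has
-- π u = a, π v = b.
record IsSimpleContraction (G : Graph) (M : EdgeSet G) (G' : Graph) : Set where
  field
    π      : Fin (n G) → Fin (n G')
    π-surj : ∀ a → ∃ λ u → π u ≡ a
    π-eq   : ∀ u v → (π u ≡ π v → u ≡ v ⊎ M u v) × (u ≡ v ⊎ M u v → π u ≡ π v)
    adj-iff : ∀ a b →
      (Adj G' a b → a ≢ b × Σ (Fin (n G)) λ u → Σ (Fin (n G)) λ v →
                      π u ≡ a × π v ≡ b × Adj G u v × ¬ M u v)
      × (a ≢ b → Σ (Fin (n G)) (λ u → Σ (Fin (n G)) λ v →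
                      π u ≡ a × π v ≡ b × Adj G u v × ¬ M u v) → Adj G' a b)

record EdgeColoring (G : Graph) (k : ℕ) : Set where
  field
    col    : ∀ u v → Adj G u v → Fin k
    colSym : ∀ u v (p : Adj G u v) (q : Adj G v u) → col u v p ≡ col v u q
open EdgeColoring public

UsesAllColors : ∀ {G k} → EdgeColoring G k → Set
UsesAllColors {G} {k} Γ = ∀ (i : Fin k) →
  Σ (Fin (n G)) λ u → Σ (Fin (n G)) λ v → Σ (Adj G u v) λ p → col Γ u v p ≡ i

IsMDColoring : ∀ {G k} → EdgeColoring G k → Set
IsMDColoring {G} {k} Γ = ∀ (u v : Fin (n G)) → u ≢ v →
  Σ (Fin (n G) → Bool) λ X → X u ≢ X v ×
    Σ (Fin k) λ i → ∀ a b (p : Adj G a b) → X a ≢ X b → col Γ a b p ≡ i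

IsMd : Graph → ℕ → Set
IsMd G m =
  (Σ (EdgeColoring G m) λ Γ → UsesAllColors Γ × IsMDColoring Γ) ×
  (∀ k (Γ : EdgeColoring G k) → UsesAllColors Γ → IsMDColoring Γ → k ≤ m)

module Submission where

-- Only the fact that M is an edge-cut, say the cut of a side
-- X ⊆ V(G), is used.  Let π : G → G' be the contraction map and Γ' an
-- MD-colouring of G' using all of its m' colours.  Colour G with m' + 1
-- colours: an edge uv with both ends on the same side of X is not in M, so
-- π u π v is an edge of G' and uv receives its Γ'-colour; the edges
-- crossing X (these are exactly the edges of M) receive the new colour m'.
--   * All colours are used: the new one because G is connected, so some
--     edge crosses X; the old ones because every edge of G' is the image of
--     an edge of G outside M.
--   * It is an MD-colouring: if π u = π v then uv ∈ M and the cut of X is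
--     monochromatic; otherwise a monochromatic cut of G' separating π u and
--     π v pulls back along π to a monochromatic cut of G.

open import Defs
open import Data.Nat using (ℕ; _≤_; _∸_; suc)
open import Data.Nat.Properties using (∸-monoˡ-≤)
open import Data.Fin using (Fin; fromℕ; inject₁)
open import Data.Fin.Properties using () renaming (_≟_ to _≟ᶠ_)
open import Data.Fin.Relation.Unary.Top using (view; ‵fromℕ; ‵inject₁)
open import Data.Bool using (Bool; true; false; T)
open import Data.Bool.Properties using (T-irrelevant) renaming (_≟_ to _≟ᵇ_)
open import Data.Product using (Σ; _×_; _,_; proj₁; proj₂)
open import Data.Sum using (inj₁; inj₂)
open import Data.Empty using (⊥-elim)
open import Relation.Nullary using (¬_; Dec; yes; no)
open import Relation.Binary.PropositionalEquality
  using (_≡_; _≢_; refl; trans; cong; subst)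
  renaming (sym to ≡-sym)

adjacent-distinct : (G : Graph) → ∀ {u v} → Adj G u v → u ≢ v
adjacent-distinct G {u} p refl = subst T (irrefl G u) p

walk-leaves : (G : Graph) (X : Fin (n G) → Bool) → ∀ {x y} → Walk G x y →
  X x ≡ true → X y ≡ false →
  Σ (Fin (n G)) λ a → Σ (Fin (n G)) λ b → Adj G a b × X a ≡ true × X b ≡ false
walk-leaves G X here inX outY with trans (≡-sym inX) outY
... | ()
walk-leaves G X (step {u} {v} p w) inU outY with X v in inV
... | true  = walk-leaves G X w inV outY
... | false = u , v , p , inU , inV

colour-irrelevant : ∀ {G k} (Γ : EdgeColoring G k) {u v} (p q : Adj G u v) →
  col Γ u v p ≡ col Γ u v q
colour-irrelevant Γ p q = cong (col Γ _ _) (T-irrelevant p q)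

module EdgeCutContraction
  (G : Graph) (M : EdgeSet G) (cut : IsEdgeCut G M)
  (G' : Graph) (C : IsSimpleContraction G M G') where

  open IsSimpleContraction C

  X : Fin (n G) → Bool
  X = proj₁ cut

  cut-crosses : ∀ {u v} → M u v → X u ≢ X v
  cut-crosses {u} {v} uv = proj₂ (proj₁ (proj₂ (proj₂ (proj₂ cut)) u v) uv)

  crossing-in-cut : ∀ {u v} → Adj G u v → X u ≢ X v → M u v
  crossing-in-cut {u} {v} = proj₂ (proj₂ (proj₂ (proj₂ cut)) u v)

  image-edge : ∀ {u v} → Adj G u v → ¬ M u v → Adj G' (π u) (π v)
  image-edge {u} {v} p notM =
    proj₂ (adj-iff (π u) (π v)) distinct-images (u , v , refl , refl , p , notM)
    where
    distinct-images : π u ≢ π v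
    distinct-images same with proj₁ (π-eq u v) same
    ... | inj₁ u≡v = adjacent-distinct G p u≡v
    ... | inj₂ uv  = notM uv

  module Lift {k : ℕ} (Γ' : EdgeColoring G' k) where

    liftedColour : ∀ u v → Adj G u v → Dec (X u ≡ X v) → Fin (suc k)
    liftedColour u v p (yes same) =
      inject₁ (col Γ' (π u) (π v) (image-edge p (λ uv → cut-crosses uv same)))
    liftedColour u v p (no _) = fromℕ k

    liftedColour-sym : ∀ u v p q (d : Dec (X u ≡ X v)) (d' : Dec (X v ≡ X u)) →
      liftedColour u v p d ≡ liftedColour v u q d'
    liftedColour-sym u v p q (yes _)   (yes _)    = cong inject₁ (colSym Γ' _ _ _ _)
    liftedColour-sym u v p q (yes uv)  (no ¬vu)   = ⊥-elim (¬vu (≡-sym uv))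
    liftedColour-sym u v p q (no ¬uv)  (yes vu)   = ⊥-elim (¬uv (≡-sym vu))
    liftedColour-sym u v p q (no _)    (no _)     = refl

    lifted : EdgeColoring G (suc k)
    lifted = record
      { col    = λ u v p → liftedColour u v p (X u ≟ᵇ X v)
      ; colSym = λ u v p q → liftedColour-sym u v p q (X u ≟ᵇ X v) (X v ≟ᵇ X u)
      }

    crossing-colour : ∀ {a b} p (d : Dec (X a ≡ X b)) → X a ≢ X b →
      liftedColour a b p d ≡ fromℕ k
    crossing-colour p (yes same) cross = ⊥-elim (cross same)
    crossing-colour p (no _)     cross = refl

    image-colour : ∀ {a b} p (q : Adj G' (π a) (π b)) (d : Dec (X a ≡ X b)) →
      ¬ M a b → liftedColour a b p d ≡ inject₁ (col Γ' (π a) (π b) q)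
    image-colour p q (yes _)     notM = cong inject₁ (colour-irrelevant Γ' _ q)
    image-colour p q (no cross)  notM = ⊥-elim (notM (crossing-in-cut p cross))

    lifted-uses-all : Connected G → UsesAllColors Γ' → UsesAllColors lifted
    lifted-uses-all conn all' i with view i
    ... | ‵fromℕ with proj₁ (proj₂ cut) | proj₁ (proj₂ (proj₂ cut))
    ...   | (x , inX) | (y , outY) with walk-leaves G X (conn x y) inX outY
    ...     | (a , b , p , inA , outB) =
              a , b , p , crossing-colour p (X a ≟ᵇ X b) crosses
      where
      crosses : X a ≢ X b
      crosses same with trans (≡-sym inA) (trans same outB)
      ... | ()
    lifted-uses-all conn all' i | ‵inject₁ j with all' j
    ... | (a , b , q , colq) with proj₁ (adj-iff a b) q
    ...   | (_ , u , v , refl , refl , p , notM) =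
              u , v , p , trans (image-colour p q (X u ≟ᵇ X v) notM) (cong inject₁ colq)

    lifted-md : IsMDColoring Γ' → IsMDColoring lifted
    lifted-md md' u v u≢v with π u ≟ᶠ π v
    ... | yes same with proj₁ (π-eq u v) same
    ...   | inj₁ u≡v = ⊥-elim (u≢v u≡v)
    ...   | inj₂ uv  = X , cut-crosses uv , fromℕ k ,
                       λ a b p cross → crossing-colour p (X a ≟ᵇ X b) cross
    lifted-md md' u v u≢v | no distinct with md' (π u) (π v) distinct
    ... | (X' , separates , i , mono) =
          (λ a → X' (π a)) , separates , inject₁ i , monochromatic
      where
      not-contracted : ∀ {a b} → X' (π a) ≢ X' (π b) → ¬ M a b
      not-contracted {a} {b} cross ab = cross (cong X' (proj₂ (π-eq a b) (inj₂ ab)))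

      monochromatic : ∀ a b (p : Adj G a b) → X' (π a) ≢ X' (π b) →
        liftedColour a b p (X a ≟ᵇ X b) ≡ inject₁ i
      monochromatic a b p cross =
        let q = image-edge p (not-contracted cross) in
        trans (image-colour p q (X a ≟ᵇ X b) (not-contracted cross))
              (cong inject₁ (mono (π a) (π b) q cross))

lemma3p5 : (G : Graph) → Connected G → (M : EdgeSet G) → IsMinimalMatchingCut G M →
    (G' : Graph) → IsSimpleContraction G M G' →
    (m m' : ℕ) → IsMd G m → IsMd G' m' → m' ≤ m ∸ 1
lemma3p5 G conn M ((cut , _) , _) G' C m m' (_ , md-maximal) ((Γ' , all' , md') , _) =
  ∸-monoˡ-≤ 1 (md-maximal (suc m') lifted (lifted-uses-all conn all') (lifted-md md'))
  where open EdgeCutContraction.Lift G M cut G' C Γ'
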